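{- Equip $S_\infty=\bigcup_n\mathbb{Q}[y_1,\dots,y_n]$ (and its Laurent extension) with the $\mathbb{Z}^2$-grading given by $\deg y_i=(1,0)$ if $i$ is odd and $\deg y_i=(0,1)$ if $i$ is even. Then for every $i\ge1$ the $i$-th Lecture Hall polynomial $\ell_i$ is homogeneous of degree $(i,i-1)$.
   Context: For a sequence $\mathbf{P}=P_1,P_2,\dots$ of elements of $\operatorname{Quot}(S_\infty)$, define the infinite matrix $M(\mathbf{P})$ by $M(\mathbf{P})_{i,j}=-P_{j-i+1}$ if $j\ge i$ and $0$ otherwise ($i,j\ge1$). For $i\ge 1$ let $\mathcal{E}_i(\mathbf{P})$ be the negative of the determinant of the square submatrix of $M(\mathbf{P})$ with rows $1,\dots,\lceil i/2\rceil$ and columns $\lfloor i/2\rfloor+1,\dots,i$. The Lecture Hall polynomials $\ell_1,\ell_2,\dots$ are the unique elements of $\operatorname{Quot}(S_\infty)$ with $\mathcal{E}_i(\ell_1,\ell_2,\dots)=y_1^{i}y_2^{i-1}\cdots y_{i-1}^2y_i$ for all $i\ge1$; they are Laurent polynomials in the $y_j$ (e.g. $\ell_1=y_1$, $\ell_2=y_1^2y_2$, $\ell_3=y_1^2y_2^2(y_1+y_3)$). -}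

module Defs where

open import Data.Nat as ℕ using (ℕ; zero; suc; _∸_; _≤?_; ⌊_/2⌋; ⌈_/2⌉)
open import Data.Integer as ℤ using (ℤ; +_)
open import Data.Rational as ℚ using (ℚ)
open import Data.Fin using (Fin; zero; suc; toℕ; punchIn)
open import Data.List using (List; []; _∷_; _++_; map; concatMap; foldr)
open import Data.List.Properties using (≡-dec)
open import Data.Product using (_×_; _,_; proj₁; proj₂)
open import Relation.Nullary using (yes; no; ¬_)
open import Relation.Binary.PropositionalEquality using (_≡_)

-- An exponent vector is a list of integers (e₁, e₂, …, eₙ) standing for
-- the Laurent monomial y₁^e₁ ⋯ yₙ^eₙ; missing trailing entries are 0.
-- A Laurent polynomial is a finite formal sum of terms (coefficient,
-- exponent vector); two are equal iff all their coefficients agree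
-- (see `coeff` and `_≈_`).

Exps : Set
Exps = List ℤ

strip : Exps → Exps
strip []      = []
strip (e ∷ es) with strip es
... | []      with e ℤ.≟ + 0
...   | yes _ = []
...   | no  _ = e ∷ []
strip (e ∷ es) | r ∷ rs = e ∷ r ∷ rs

addExps : Exps → Exps → Exps
addExps []       fs       = fs
addExps (e ∷ es) []       = e ∷ es
addExps (e ∷ es) (f ∷ fs) = (e ℤ.+ f) ∷ addExps es fs

Term : Set
Term = ℚ × Exps

LP : Set
LP = List Term

coeff : LP → Exps → ℚ
coeff []            m = ℚ.0ℚ
coeff ((c , e) ∷ p) m with ≡-dec ℤ._≟_ (strip e) (strip m)
... | yes _ = c ℚ.+ coeff p m
... | no  _ = coeff p m

_≈_ : LP → LP → Set
p ≈ q = ∀ m → coeff p m ≡ coeff q m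

0L : LP
0L = []

1L : LP
1L = (ℚ.1ℚ , []) ∷ []

_+L_ : LP → LP → LP
p +L q = p ++ q

-L_ : LP → LP
-L p = map (λ { (c , e) → (ℚ.- c , e) }) p

_*L_ : LP → LP → LP
p *L q = concatMap (λ { (c , e) → map (λ { (d , f) → (c ℚ.* d , addExps e f) }) q }) p

sumFin : ∀ n → (Fin n → LP) → LP
sumFin zero    f = 0L
sumFin (suc n) f = f zero +L sumFin n (λ j → f (suc j))

sign : ℕ → LP → LP
sign zero          p = p
sign (suc zero)    p = -L p
sign (suc (suc k)) p = sign k p

det : ∀ n → (Fin n → Fin n → LP) → LP
det zero    M = 1L
det (suc n) M =
  sumFin (suc n) (λ j →
    sign (toℕ j) (M zero j *L det n (λ r c → M (suc r) (punchIn j c))))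

-- The matrix M(P) and the functionals 𝓔ᵢ.
-- Sequences P = P₁, P₂, … are functions ℕ → LP, where P k is P_k
-- (the value at 0 is never used).

-- entry (a , b) of M(P), 1-indexed: -P_{b-a+1} if b ≥ a, else 0
Mentry : (ℕ → LP) → ℕ → ℕ → LP
Mentry P a b with a ℕ.≤? b
... | yes _ = -L P (b ∸ a ℕ.+ 1)
... | no  _ = 0L

-- 𝓔ᵢ(P) = - det of rows 1..⌈i/2⌉, columns ⌊i/2⌋+1..i  (a square ⌈i/2⌉ matrix)
𝓔 : ℕ → (ℕ → LP) → LP
𝓔 i P = -L det ⌈ i /2⌉
  (λ r c → Mentry P (suc (toℕ r)) (⌊ i /2⌋ ℕ.+ suc (toℕ c)))

staircase : ℕ → Exps
staircase zero    = []
staircase (suc k) = + suc k ∷ staircase k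

stairMono : ℕ → LP
stairMono i = (ℚ.1ℚ , staircase i) ∷ []

-- The ℤ²-grading: deg yᵢ = (1,0) for i odd, (0,1) for i even.

deg : Exps → ℤ × ℤ
deg []       = (+ 0 , + 0)
deg (e ∷ es) = (e ℤ.+ proj₂ (deg es) , proj₁ (deg es))

Homogeneous : LP → ℤ × ℤ → Set
Homogeneous p d = ∀ m → ¬ (coeff p m ≡ ℚ.0ℚ) → deg m ≡ d

module Submission where

-- Write h = ⌊i/2⌋ and k = ⌈i/2⌉. In the k × k matrix M with det M = -𝓔ᵢ(ℓ), the
-- entry in row a and column h + b is -ℓ_{h+b-a+1}, so ℓᵢ occurs only in the top right corner and
-- every other entry involves some ℓⱼ with j < i, homogeneous of degree (j, j-1) by induction.
-- Replacing each ℓⱼ by its component ℓⱼ⁰ of degree (j, j-1) gives a matrix M⁰ whose entry (a, b)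
-- has degree (h+1, h) + (b-a, b-a), so det M⁰ is homogeneous of degree k·(h+1, h), the degree of
-- y₁^i ⋯ yᵢ; so is det M = -y₁^i ⋯ yᵢ. Expanding along the first row, det M - det M⁰ is
-- ±(ℓᵢ - ℓᵢ⁰) times the corner minor, which is 1 or -𝓔_{i-2}(ℓ) = -y₁^{i-2} ⋯ y_{i-2}. Hence
-- every monomial of ℓᵢ - ℓᵢ⁰ has degree deg(y₁^i ⋯ yᵢ) - deg(y₁^{i-2} ⋯ y_{i-2}) = (i, i-1);
-- as ℓᵢ - ℓᵢ⁰ has no monomial of that degree, ℓᵢ = ℓᵢ⁰.

open import Defs
open import Data.Nat as ℕ using (ℕ; zero; suc; _∸_; _≤_; _<_; ⌊_/2⌋; ⌈_/2⌉; s≤s; z≤n)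
import Data.Nat.Properties as ℕP
import Data.Nat.Tactic.RingSolver as ℕ-Solver
open import Data.Integer as ℤ using (ℤ; +_)
import Data.Integer.Properties as ℤP
import Data.Integer.Tactic.RingSolver as ℤ-Solver
open import Data.Rational using (ℚ; 0ℚ; 1ℚ; _+_; _*_; -_)
import Data.Rational.Properties as ℚP
open import Algebra.Properties.Group ℚP.+-0-group using (⁻¹-involutive)
open import Algebra.Properties.AbelianGroup ℤP.+-0-abelianGroup
  using () renaming (∙-cancelʳ to ℤ-+-cancelʳ)
open import Data.Fin using (Fin; zero; suc; toℕ; punchIn; fromℕ)
import Data.Fin.Properties as FinP
open import Data.List using ([]; _∷_; map; filter)
open import Data.List.Properties using (≡-dec; ++-assoc)
open import Data.List.Relation.Unary.All using (All; []; _∷_)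
open import Data.List.Relation.Unary.All.Properties using (++⁺; map⁺; all-filter)
import Data.Product.Properties as ×P
open import Data.Product using (_×_; _,_; proj₁; proj₂; Σ-syntax)
open import Data.Sum using (_⊎_; inj₁; inj₂)
open import Data.Empty using (⊥-elim)
open import Function using (_∘_)
open import Relation.Nullary using (Dec; yes; no; ¬_)
open import Relation.Binary.PropositionalEquality
open import Relation.Binary using (Setoid)
import Relation.Binary.Reasoning.Setoid as SetoidReasoning
open import Data.Maybe using (just; nothing)
open import Tactic.RingSolver using (solve-∀)
open import Tactic.RingSolver.Core.AlmostCommutativeRing
  using (AlmostCommutativeRing; fromCommutativeRing)

-- Exponent vectors and their degrees

exponent : Exps → ℕ → ℤ
exponent []       _       = + 0
exponent (e ∷ _)  zero    = e
exponent (_ ∷ es) (suc n) = exponent es n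

infix 4 _≋_
_≋_ : Exps → Exps → Set
e ≋ f = ∀ n → exponent e n ≡ exponent f n

stripCons : ℤ → Exps → Exps
stripCons e [] with e ℤ.≟ + 0
... | yes _ = []
... | no  _ = e ∷ []
stripCons e (r ∷ rs) = e ∷ r ∷ rs

strip-∷ : ∀ e es → strip (e ∷ es) ≡ stripCons e (strip es)
strip-∷ e es with strip es
... | [] with e ℤ.≟ + 0
...   | yes _ = refl
...   | no  _ = refl
strip-∷ e es | r ∷ rs = refl

exponent-stripCons : ∀ e es n → exponent (stripCons e es) n ≡ exponent (e ∷ es) n
exponent-stripCons e [] zero with e ℤ.≟ + 0
... | yes e≡0 = sym e≡0
... | no  _   = refl
exponent-stripCons e [] (suc n) with e ℤ.≟ + 0
... | yes _ = refl
... | no  _ = refl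
exponent-stripCons e (_ ∷ _) n = refl

exponent-strip : ∀ e n → exponent (strip e) n ≡ exponent e n
exponent-strip []       n = refl
exponent-strip (e ∷ es) n =
  trans (cong (λ r → exponent r n) (strip-∷ e es))
        (trans (exponent-stripCons e (strip es) n) (exponent-∷ n))
  where
  exponent-∷ : ∀ n → exponent (e ∷ strip es) n ≡ exponent (e ∷ es) n
  exponent-∷ zero    = refl
  exponent-∷ (suc n) = exponent-strip es n

strip-≋[] : ∀ e → e ≋ [] → strip e ≡ []
strip-≋[] []       _    = refl
strip-≋[] (e ∷ es) e≋[] rewrite strip-∷ e es | strip-≋[] es (e≋[] ∘ suc) with e ℤ.≟ + 0
... | yes _  = refl
... | no e≢0 = ⊥-elim (e≢0 (e≋[] 0))

≋⇒strip≡ : ∀ e f → e ≋ f → strip e ≡ strip f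
≋⇒strip≡ []       []       _   = refl
≋⇒strip≡ []       (f ∷ fs) e≋f = sym (strip-≋[] (f ∷ fs) (sym ∘ e≋f))
≋⇒strip≡ (e ∷ es) []       e≋f = strip-≋[] (e ∷ es) e≋f
≋⇒strip≡ (e ∷ es) (f ∷ fs) e≋f
  rewrite strip-∷ e es | strip-∷ f fs | e≋f 0 | ≋⇒strip≡ es fs (e≋f ∘ suc) = refl

strip≡⇒≋ : ∀ e f → strip e ≡ strip f → e ≋ f
strip≡⇒≋ e f eq n =
  trans (sym (exponent-strip e n)) (trans (cong (λ r → exponent r n) eq) (exponent-strip f n))

Degree : Set
Degree = ℤ × ℤ

infixl 6 _⊕_ _⊖_
_⊕_ _⊖_ : Degree → Degree → Degree
(a , b) ⊕ (c , d) = (a ℤ.+ c , b ℤ.+ d)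
(a , b) ⊖ (c , d) = (a ℤ.- c , b ℤ.- d)

⊕-cancelʳ : ∀ x y z → x ⊕ z ≡ y ⊕ z → x ≡ y
⊕-cancelʳ (a , b) (c , d) (e , f) eq =
  cong₂ _,_ (ℤ-+-cancelʳ e a c (cong proj₁ eq)) (ℤ-+-cancelʳ f b d (cong proj₂ eq))

⊕-⊖-self : ∀ x s → x ⊕ (s ⊖ s) ≡ x
⊕-⊖-self (a , b) (c , d) =
  cong₂ _,_ (trans (cong (ℤ._+_ a) (ℤP.+-inverseʳ c)) (ℤP.+-identityʳ a))
            (trans (cong (ℤ._+_ b) (ℤP.+-inverseʳ d)) (ℤP.+-identityʳ b))

deg-stripCons : ∀ e es → deg (stripCons e es) ≡ deg (e ∷ es)
deg-stripCons e [] with e ℤ.≟ + 0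
... | yes refl = refl
... | no  _    = refl
deg-stripCons e (_ ∷ _) = refl

deg-strip : ∀ e → deg (strip e) ≡ deg e
deg-strip []       = refl
deg-strip (e ∷ es) rewrite strip-∷ e es | deg-stripCons e (strip es) | deg-strip es = refl

deg-cong : ∀ {e f} → e ≋ f → deg e ≡ deg f
deg-cong {e} {f} e≋f = trans (sym (deg-strip e)) (trans (cong deg (≋⇒strip≡ e f e≋f)) (deg-strip f))

subExps : Exps → Exps → Exps
subExps []       []       = []
subExps (m ∷ ms) []       = m ∷ ms
subExps []       (e ∷ es) = ℤ.- e ∷ subExps [] es
subExps (m ∷ ms) (e ∷ es) = (m ℤ.- e) ∷ subExps ms es

exponent-addExps : ∀ e f n → exponent (addExps e f) n ≡ exponent e n ℤ.+ exponent f n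
exponent-addExps []       f        n       = sym (ℤP.+-identityˡ _)
exponent-addExps (e ∷ es) []       n       = sym (ℤP.+-identityʳ _)
exponent-addExps (e ∷ es) (f ∷ fs) zero    = refl
exponent-addExps (e ∷ es) (f ∷ fs) (suc n) = exponent-addExps es fs n

exponent-subExps : ∀ m e n → exponent (subExps m e) n ≡ exponent m n ℤ.- exponent e n
exponent-subExps []       []       n       = refl
exponent-subExps (m ∷ ms) []       n       = sym (ℤP.+-identityʳ _)
exponent-subExps []       (e ∷ es) zero    = sym (ℤP.+-identityˡ _)
exponent-subExps []       (e ∷ es) (suc n) = exponent-subExps [] es n
exponent-subExps (m ∷ ms) (e ∷ es) zero    = refl
exponent-subExps (m ∷ ms) (e ∷ es) (suc n) = exponent-subExps ms es n

deg-addExps : ∀ e f → deg (addExps e f) ≡ deg e ⊕ deg f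
deg-addExps []       f        = sym (cong₂ _,_ (ℤP.+-identityˡ _) (ℤP.+-identityˡ _))
deg-addExps (e ∷ es) []       = sym (cong₂ _,_ (ℤP.+-identityʳ _) (ℤP.+-identityʳ _))
deg-addExps (e ∷ es) (f ∷ fs) rewrite deg-addExps es fs =
  cong (_, _) (interchange e f (proj₂ (deg es)) (proj₂ (deg fs)))
  where
  interchange : ∀ a b c d → (a ℤ.+ b) ℤ.+ (c ℤ.+ d) ≡ (a ℤ.+ c) ℤ.+ (b ℤ.+ d)
  interchange = ℤ-Solver.solve-∀

addExps≋⇒≋subExps : ∀ e f m → addExps e f ≋ m → f ≋ subExps m e
addExps≋⇒≋subExps e f m e+f≋m n
  rewrite exponent-subExps m e n | sym (e+f≋m n) | exponent-addExps e f n =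
  cancel (exponent e n) (exponent f n)
  where
  cancel : ∀ a b → b ≡ (a ℤ.+ b) ℤ.- a
  cancel = ℤ-Solver.solve-∀

≋subExps⇒addExps≋ : ∀ e f m → f ≋ subExps m e → addExps e f ≋ m
≋subExps⇒addExps≋ e f m f≋m-e n
  rewrite exponent-addExps e f n | f≋m-e n | exponent-subExps m e n =
  cancel (exponent e n) (exponent m n)
  where
  cancel : ∀ a b → a ℤ.+ (b ℤ.- a) ≡ b
  cancel = ℤ-Solver.solve-∀

addExps-comm : ∀ e f → addExps e f ≋ addExps f e
addExps-comm e f n rewrite exponent-addExps e f n | exponent-addExps f e n =
  ℤP.+-comm (exponent e n) (exponent f n)

≋subExps-swap : ∀ e f m → f ≋ subExps m e → e ≋ subExps m f
≋subExps-swap e f m f≋m-e =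
  addExps≋⇒≋subExps f e m (λ n → trans (addExps-comm f e n) (≋subExps⇒addExps≋ e f m f≋m-e n))

subExps-addExps : ∀ m e → subExps (addExps m e) e ≋ m
subExps-addExps m e = sym ∘ addExps≋⇒≋subExps e m (addExps m e) (addExps-comm e m)

-- Coefficients

ℚ-ring : AlmostCommutativeRing _ _
ℚ-ring = fromCommutativeRing ℚP.+-*-commutativeRing isZero
  where
  isZero : ∀ x → _
  isZero x with 0ℚ ℚP.≟ x
  ... | yes 0≡x = just 0≡x
  ... | no  _   = nothing

termCoeff : Term → Exps → ℚ
termCoeff (c , e) m with ≡-dec ℤ._≟_ (strip e) (strip m)
... | yes _ = c
... | no  _ = 0ℚ

coeff-∷ : ∀ t p m → coeff (t ∷ p) m ≡ termCoeff t m + coeff p m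
coeff-∷ (c , e) p m with ≡-dec ℤ._≟_ (strip e) (strip m)
... | yes _ = refl
... | no  _ = sym (ℚP.+-identityˡ _)

termCoeff-≋ : ∀ c e m → e ≋ m → termCoeff (c , e) m ≡ c
termCoeff-≋ c e m e≋m with ≡-dec ℤ._≟_ (strip e) (strip m)
... | yes _   = refl
... | no  e≉m = ⊥-elim (e≉m (≋⇒strip≡ e m e≋m))

termCoeff-≉ : ∀ c e m → ¬ e ≋ m → termCoeff (c , e) m ≡ 0ℚ
termCoeff-≉ c e m e≉m with ≡-dec ℤ._≟_ (strip e) (strip m)
... | yes eq = ⊥-elim (e≉m (strip≡⇒≋ e m eq))
... | no  _  = refl

termCoeff-cong : ∀ c e m e′ m′ → (e ≋ m → e′ ≋ m′) → (e′ ≋ m′ → e ≋ m) →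
                 termCoeff (c , e) m ≡ termCoeff (c , e′) m′
termCoeff-cong c e m e′ m′ to from with ≡-dec ℤ._≟_ (strip e) (strip m)
... | yes eq  = sym (termCoeff-≋ c e′ m′ (to (strip≡⇒≋ e m eq)))
... | no  e≉m = sym (termCoeff-≉ c e′ m′ (e≉m ∘ ≋⇒strip≡ e m ∘ from))

termCoeff-*ˡ : ∀ c d e m → termCoeff (c * d , e) m ≡ c * termCoeff (d , e) m
termCoeff-*ˡ c d e m with ≡-dec ℤ._≟_ (strip e) (strip m)
... | yes _ = refl
... | no  _ = sym (ℚP.*-zeroʳ c)

termCoeff-*ʳ : ∀ c d e m → termCoeff (c * d , e) m ≡ termCoeff (c , e) m * d
termCoeff-*ʳ c d e m with ≡-dec ℤ._≟_ (strip e) (strip m)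
... | yes _ = refl
... | no  _ = sym (ℚP.*-zeroˡ d)

termCoeff-neg : ∀ c e m → termCoeff (- c , e) m ≡ - termCoeff (c , e) m
termCoeff-neg c e m with ≡-dec ℤ._≟_ (strip e) (strip m)
... | yes _ = refl
... | no  _ = refl

coeff-≋ : ∀ p {m m′} → m ≋ m′ → coeff p m ≡ coeff p m′
coeff-≋ []            _ = refl
coeff-≋ ((c , e) ∷ p) {m} {m′} m≋m′ = begin
  coeff ((c , e) ∷ p) m               ≡⟨ coeff-∷ (c , e) p m ⟩
  termCoeff (c , e) m + coeff p m     ≡⟨ cong₂ _+_ (termCoeff-cong c e m e m′ e≋m⇒e≋m′ e≋m′⇒e≋m)
                                                   (coeff-≋ p m≋m′) ⟩
  termCoeff (c , e) m′ + coeff p m′   ≡⟨ coeff-∷ (c , e) p m′ ⟨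
  coeff ((c , e) ∷ p) m′              ∎
  where
  open ≡-Reasoning
  e≋m⇒e≋m′ : e ≋ m → e ≋ m′
  e≋m⇒e≋m′ e≋m n = trans (e≋m n) (m≋m′ n)
  e≋m′⇒e≋m : e ≋ m′ → e ≋ m
  e≋m′⇒e≋m e≋m′ n = trans (e≋m′ n) (sym (m≋m′ n))

coeff-+L : ∀ p q m → coeff (p +L q) m ≡ coeff p m + coeff q m
coeff-+L []      q m = sym (ℚP.+-identityˡ _)
coeff-+L (t ∷ p) q m rewrite coeff-∷ t (p +L q) m | coeff-∷ t p m | coeff-+L p q m =
  sym (ℚP.+-assoc (termCoeff t m) (coeff p m) (coeff q m))

coeff--L : ∀ p m → coeff (-L p) m ≡ - coeff p m
coeff--L []            m = refl
coeff--L ((c , e) ∷ p) m = begin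
  coeff ((- c , e) ∷ -L p) m                      ≡⟨ coeff-∷ (- c , e) (-L p) m ⟩
  termCoeff (- c , e) m + coeff (-L p) m          ≡⟨ cong₂ _+_ (termCoeff-neg c e m) (coeff--L p m) ⟩
  - termCoeff (c , e) m + - coeff p m             ≡⟨ ℚP.neg-distrib-+ (termCoeff (c , e) m) (coeff p m) ⟨
  - (termCoeff (c , e) m + coeff p m)             ≡⟨ cong -_ (coeff-∷ (c , e) p m) ⟨
  - coeff ((c , e) ∷ p) m                         ∎
  where open ≡-Reasoning

timesTerm : Term → Term → Term
timesTerm (c , e) (d , f) = (c * d , addExps e f)

coeff-map-timesTerm : ∀ c e q m → coeff (map (timesTerm (c , e)) q) m ≡ c * coeff q (subExps m e)
coeff-map-timesTerm c e []            m = sym (ℚP.*-zeroʳ c)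
coeff-map-timesTerm c e ((d , f) ∷ q) m = begin
  coeff ((c * d , addExps e f) ∷ map (timesTerm (c , e)) q) m
    ≡⟨ coeff-∷ (c * d , addExps e f) (map (timesTerm (c , e)) q) m ⟩
  termCoeff (c * d , addExps e f) m + coeff (map (timesTerm (c , e)) q) m
    ≡⟨ cong₂ _+_ (termCoeff-cong (c * d) (addExps e f) m f m-e
                                 (addExps≋⇒≋subExps e f m) (≋subExps⇒addExps≋ e f m))
                 (coeff-map-timesTerm c e q m) ⟩
  termCoeff (c * d , f) m-e + c * coeff q m-e
    ≡⟨ cong (_+ c * coeff q m-e) (termCoeff-*ˡ c d f m-e) ⟩
  c * termCoeff (d , f) m-e + c * coeff q m-e
    ≡⟨ ℚP.*-distribˡ-+ c (termCoeff (d , f) m-e) (coeff q m-e) ⟨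
  c * (termCoeff (d , f) m-e + coeff q m-e)
    ≡⟨ cong (c *_) (coeff-∷ (d , f) q m-e) ⟨
  c * coeff ((d , f) ∷ q) m-e ∎
  where
  open ≡-Reasoning
  m-e = subExps m e

coeff-*L-∷ˡ : ∀ c e p q m →
              coeff (((c , e) ∷ p) *L q) m ≡ c * coeff q (subExps m e) + coeff (p *L q) m
coeff-*L-∷ˡ c e p q m =
  trans (coeff-+L (map (timesTerm (c , e)) q) (p *L q) m)
        (cong (_+ coeff (p *L q) m) (coeff-map-timesTerm c e q m))

≈-setoid : Setoid _ _
≈-setoid = record
  { Carrier       = LP
  ; _≈_           = _≈_
  ; isEquivalence = record
    { refl  = λ _ → refl
    ; sym   = λ p≈q m → sym (p≈q m)
    ; trans = λ p≈q q≈r m → trans (p≈q m) (q≈r m)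
    }
  }

*L-congʳ : ∀ p q q′ → q ≈ q′ → (p *L q) ≈ (p *L q′)
*L-congʳ []            q q′ q≈q′ m = refl
*L-congʳ ((c , e) ∷ p) q q′ q≈q′ m = begin
  coeff (((c , e) ∷ p) *L q) m                    ≡⟨ coeff-*L-∷ˡ c e p q m ⟩
  c * coeff q (subExps m e) + coeff (p *L q) m    ≡⟨ cong₂ _+_ (cong (c *_) (q≈q′ (subExps m e)))
                                                               (*L-congʳ p q q′ q≈q′ m) ⟩
  c * coeff q′ (subExps m e) + coeff (p *L q′) m  ≡⟨ coeff-*L-∷ˡ c e p q′ m ⟨
  coeff (((c , e) ∷ p) *L q′) m                   ∎
  where open ≡-Reasoning

coeff-*L-[] : ∀ p m → coeff (p *L []) m ≡ 0ℚ
coeff-*L-[] []            m = refl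
coeff-*L-[] ((c , e) ∷ p) m =
  trans (coeff-*L-∷ˡ c e p [] m) (cong₂ _+_ (ℚP.*-zeroʳ c) (coeff-*L-[] p m))

coeff-*L-monomial : ∀ p d f m → coeff (p *L ((d , f) ∷ [])) m ≡ coeff p (subExps m f) * d
coeff-*L-monomial []            d f m = sym (ℚP.*-zeroˡ d)
coeff-*L-monomial ((c , e) ∷ p) d f m = begin
  coeff (((c , e) ∷ p) *L ((d , f) ∷ [])) m
    ≡⟨ coeff-*L-∷ˡ c e p ((d , f) ∷ []) m ⟩
  c * coeff ((d , f) ∷ []) m-e + coeff (p *L ((d , f) ∷ [])) m
    ≡⟨ cong₂ _+_ leading (coeff-*L-monomial p d f m) ⟩
  termCoeff (c , e) m-f * d + coeff p m-f * d
    ≡⟨ ℚP.*-distribʳ-+ d (termCoeff (c , e) m-f) (coeff p m-f) ⟨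
  (termCoeff (c , e) m-f + coeff p m-f) * d
    ≡⟨ cong (_* d) (coeff-∷ (c , e) p m-f) ⟨
  coeff ((c , e) ∷ p) m-f * d ∎
  where
  open ≡-Reasoning
  m-e = subExps m e
  m-f = subExps m f
  leading : c * coeff ((d , f) ∷ []) m-e ≡ termCoeff (c , e) m-f * d
  leading = begin
    c * coeff ((d , f) ∷ []) m-e  ≡⟨ cong (c *_) (trans (coeff-∷ (d , f) [] m-e) (ℚP.+-identityʳ _)) ⟩
    c * termCoeff (d , f) m-e     ≡⟨ termCoeff-*ˡ c d f m-e ⟨
    termCoeff (c * d , f) m-e     ≡⟨ termCoeff-cong (c * d) f m-e e m-f
                                                    (≋subExps-swap e f m) (≋subExps-swap f e m) ⟩
    termCoeff (c * d , e) m-f     ≡⟨ termCoeff-*ʳ c d e m-f ⟩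
    termCoeff (c , e) m-f * d     ∎

coeff-*L-∷ʳ : ∀ p t q m → coeff (p *L (t ∷ q)) m ≡ coeff (p *L (t ∷ [])) m + coeff (p *L q) m
coeff-*L-∷ʳ []            t q m = refl
coeff-*L-∷ʳ ((c , e) ∷ p) t q m = begin
  coeff (((c , e) ∷ p) *L (t ∷ q)) m
    ≡⟨ coeff-*L-∷ˡ c e p (t ∷ q) m ⟩
  c * coeff (t ∷ q) m-e + coeff (p *L (t ∷ q)) m
    ≡⟨ cong₂ _+_ (cong (c *_) (coeff-∷ t q m-e)) (coeff-*L-∷ʳ p t q m) ⟩
  c * (termCoeff t m-e + coeff q m-e) + (coeff (p *L (t ∷ [])) m + coeff (p *L q) m)
    ≡⟨ distrib c (termCoeff t m-e) (coeff q m-e) (coeff (p *L (t ∷ [])) m) (coeff (p *L q) m) ⟩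
  (c * (termCoeff t m-e + 0ℚ) + coeff (p *L (t ∷ [])) m) + (c * coeff q m-e + coeff (p *L q) m)
    ≡⟨ cong₂ _+_ (cong (λ x → c * x + coeff (p *L (t ∷ [])) m) (coeff-∷ t [] m-e))
                 (coeff-*L-∷ˡ c e p q m) ⟨
  (c * coeff (t ∷ []) m-e + coeff (p *L (t ∷ [])) m) + coeff (((c , e) ∷ p) *L q) m
    ≡⟨ cong (_+ coeff (((c , e) ∷ p) *L q) m) (coeff-*L-∷ˡ c e p (t ∷ []) m) ⟨
  coeff (((c , e) ∷ p) *L (t ∷ [])) m + coeff (((c , e) ∷ p) *L q) m ∎
  where
  open ≡-Reasoning
  m-e = subExps m e
  distrib : ∀ c a b x y → c * (a + b) + (x + y) ≡ (c * (a + 0ℚ) + x) + (c * b + y)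
  distrib = solve-∀ ℚ-ring

*L-congˡ : ∀ p p′ q → p ≈ p′ → (p *L q) ≈ (p′ *L q)
*L-congˡ p p′ []            p≈p′ m = trans (coeff-*L-[] p m) (sym (coeff-*L-[] p′ m))
*L-congˡ p p′ ((d , f) ∷ q) p≈p′ m = begin
  coeff (p *L ((d , f) ∷ q)) m
    ≡⟨ coeff-*L-∷ʳ p (d , f) q m ⟩
  coeff (p *L ((d , f) ∷ [])) m + coeff (p *L q) m
    ≡⟨ cong₂ _+_ (coeff-*L-monomial p d f m) (*L-congˡ p p′ q p≈p′ m) ⟩
  coeff p (subExps m f) * d + coeff (p′ *L q) m
    ≡⟨ cong (λ x → x * d + coeff (p′ *L q) m) (p≈p′ (subExps m f)) ⟩
  coeff p′ (subExps m f) * d + coeff (p′ *L q) m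
    ≡⟨ cong (_+ coeff (p′ *L q) m) (coeff-*L-monomial p′ d f m) ⟨
  coeff (p′ *L ((d , f) ∷ [])) m + coeff (p′ *L q) m
    ≡⟨ coeff-*L-∷ʳ p′ (d , f) q m ⟨
  coeff (p′ *L ((d , f) ∷ q)) m ∎
  where open ≡-Reasoning

*L-cong : ∀ p p′ q q′ → p ≈ p′ → q ≈ q′ → (p *L q) ≈ (p′ *L q′)
*L-cong p p′ q q′ p≈p′ q≈q′ m =
  trans (*L-congˡ p p′ q p≈p′ m) (*L-congʳ p′ q q′ q≈q′ m)

+L-cong : ∀ p p′ q q′ → p ≈ p′ → q ≈ q′ → (p +L q) ≈ (p′ +L q′)
+L-cong p p′ q q′ p≈p′ q≈q′ m =
  trans (coeff-+L p q m) (trans (cong₂ _+_ (p≈p′ m) (q≈q′ m)) (sym (coeff-+L p′ q′ m)))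

+L-comm : ∀ p q → (p +L q) ≈ (q +L p)
+L-comm p q m =
  trans (coeff-+L p q m) (trans (ℚP.+-comm (coeff p m) (coeff q m)) (sym (coeff-+L q p m)))

-L-cong : ∀ p p′ → p ≈ p′ → (-L p) ≈ (-L p′)
-L-cong p p′ p≈p′ m = trans (coeff--L p m) (trans (cong -_ (p≈p′ m)) (sym (coeff--L p′ m)))

-L-involutive : ∀ p → (-L (-L p)) ≈ p
-L-involutive p m =
  trans (coeff--L (-L p) m) (trans (cong -_ (coeff--L p m)) (⁻¹-involutive (coeff p m)))

-L-*L : ∀ p q → ((-L p) *L q) ≈ (-L (p *L q))
-L-*L []            q m = refl
-L-*L ((c , e) ∷ p) q m = begin
  coeff ((-L ((c , e) ∷ p)) *L q) m       ≡⟨ coeff-*L-∷ˡ (- c) e (-L p) q m ⟩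
  - c * x + coeff ((-L p) *L q) m         ≡⟨ cong₂ _+_ (sym (ℚP.neg-distribˡ-* c x)) (-L-*L p q m) ⟩
  - (c * x) + coeff (-L (p *L q)) m       ≡⟨ cong (_+_ (- (c * x))) (coeff--L (p *L q) m) ⟩
  - (c * x) + - coeff (p *L q) m          ≡⟨ ℚP.neg-distrib-+ (c * x) (coeff (p *L q) m) ⟨
  - (c * x + coeff (p *L q) m)            ≡⟨ cong -_ (coeff-*L-∷ˡ c e p q m) ⟨
  - coeff (((c , e) ∷ p) *L q) m          ≡⟨ coeff--L (((c , e) ∷ p) *L q) m ⟨
  coeff (-L (((c , e) ∷ p) *L q)) m       ∎
  where
  open ≡-Reasoning
  x = coeff q (subExps m e)

sign-cong : ∀ n p p′ → p ≈ p′ → (sign n p) ≈ (sign n p′)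
sign-cong zero          p p′ p≈p′ = p≈p′
sign-cong (suc zero)    p p′ p≈p′ = -L-cong p p′ p≈p′
sign-cong (suc (suc n)) p p′ p≈p′ = sign-cong n p p′ p≈p′

coeff-sign-injective : ∀ n p q m →
                       coeff (sign n p) m ≡ coeff (sign n q) m → coeff p m ≡ coeff q m
coeff-sign-injective zero          p q m eq = eq
coeff-sign-injective (suc zero)    p q m eq =
  ℚP.neg-injective (trans (sym (coeff--L p m)) (trans eq (coeff--L q m)))
coeff-sign-injective (suc (suc n)) p q m eq = coeff-sign-injective n p q m eq

-- Homogeneous components

_≟ᵈ_ : (d d′ : Degree) → Dec (d ≡ d′)
_≟ᵈ_ = ×P.≡-dec ℤ._≟_ ℤ._≟_

OfDegree : Degree → Term → Set
OfDegree d t = deg (proj₂ t) ≡ d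

AllOfDegree : LP → Degree → Set
AllOfDegree p d = All (OfDegree d) p

ofDegree? : ∀ d t → Dec (OfDegree d t)
ofDegree? d t = deg (proj₂ t) ≟ᵈ d

component : Degree → LP → LP
component d = filter (ofDegree? d)

coeff-offDegree : ∀ p d m → AllOfDegree p d → ¬ deg m ≡ d → coeff p m ≡ 0ℚ
coeff-offDegree []            d m []                  _      = refl
coeff-offDegree ((c , e) ∷ p) d m (deg-e≡d ∷ p-of-d) deg-m≢d =
  trans (coeff-∷ (c , e) p m)
        (cong₂ _+_ (termCoeff-≉ c e m (λ e≋m → deg-m≢d (trans (sym (deg-cong e≋m)) deg-e≡d)))
                   (coeff-offDegree p d m p-of-d deg-m≢d))

coeff-component : ∀ d p m → deg m ≡ d → coeff (component d p) m ≡ coeff p m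
coeff-component d []            m _       = refl
coeff-component d ((c , e) ∷ p) m deg-m≡d with ofDegree? d (c , e)
... | yes deg-e≡d =
  trans (coeff-∷ (c , e) (component d p) m)
        (trans (cong (_+_ (termCoeff (c , e) m)) (coeff-component d p m deg-m≡d))
               (sym (coeff-∷ (c , e) p m)))
... | no deg-e≢d =
  trans (coeff-component d p m deg-m≡d)
        (sym (trans (coeff-∷ (c , e) p m)
                    (trans (cong (_+ coeff p m) (termCoeff-≉ c e m e≉m)) (ℚP.+-identityˡ (coeff p m)))))
  where
  e≉m : ¬ e ≋ m
  e≉m e≋m = deg-e≢d (trans (deg-cong e≋m) deg-m≡d)

Homogeneous⇒≈component : ∀ p d → Homogeneous p d → p ≈ component d p
Homogeneous⇒≈component p d p-hom m with deg m ≟ᵈ d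
... | yes deg-m≡d = sym (coeff-component d p m deg-m≡d)
... | no  deg-m≢d with coeff p m ℚP.≟ 0ℚ
...   | yes coeff≡0 =
  trans coeff≡0 (sym (coeff-offDegree (component d p) d m (all-filter (ofDegree? d) p) deg-m≢d))
...   | no  coeff≢0 = ⊥-elim (deg-m≢d (p-hom m coeff≢0))

offDegree-vanishing⇒Homogeneous : ∀ p d → (∀ m → ¬ deg m ≡ d → coeff p m ≡ 0ℚ) →
                                  Homogeneous p d
offDegree-vanishing⇒Homogeneous p d vanishes m coeff≢0 with deg m ≟ᵈ d
... | yes deg-m≡d = deg-m≡d
... | no  deg-m≢d = ⊥-elim (coeff≢0 (vanishes m deg-m≢d))

-L-AllOfDegree : ∀ p d → AllOfDegree p d → AllOfDegree (-L p) d
-L-AllOfDegree p d = map⁺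

*L-AllOfDegree : ∀ p q d₁ d₂ → AllOfDegree p d₁ → AllOfDegree q d₂ →
                 AllOfDegree (p *L q) (d₁ ⊕ d₂)
*L-AllOfDegree []            q d₁ d₂ []                 q-of-d₂ = []
*L-AllOfDegree ((c , e) ∷ p) q d₁ d₂ (deg-e≡d₁ ∷ p-of-d₁) q-of-d₂ =
  ++⁺ (scaled q q-of-d₂) (*L-AllOfDegree p q d₁ d₂ p-of-d₁ q-of-d₂)
  where
  scaled : ∀ q → AllOfDegree q d₂ → AllOfDegree (map (timesTerm (c , e)) q) (d₁ ⊕ d₂)
  scaled []            []                 = []
  scaled ((d , f) ∷ q) (deg-f≡d₂ ∷ q-of-d₂) =
    trans (deg-addExps e f) (cong₂ _⊕_ deg-e≡d₁ deg-f≡d₂) ∷ scaled q q-of-d₂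

sign-AllOfDegree : ∀ n p d → AllOfDegree p d → AllOfDegree (sign n p) d
sign-AllOfDegree zero          p d p-of-d = p-of-d
sign-AllOfDegree (suc zero)    p d p-of-d = -L-AllOfDegree p d p-of-d
sign-AllOfDegree (suc (suc n)) p d p-of-d = sign-AllOfDegree n p d p-of-d

sumFin-AllOfDegree : ∀ n f d → (∀ j → AllOfDegree (f j) d) → AllOfDegree (sumFin n f) d
sumFin-AllOfDegree zero    f d f-of-d = []
sumFin-AllOfDegree (suc n) f d f-of-d =
  ++⁺ (f-of-d zero) (sumFin-AllOfDegree n (f ∘ suc) d (f-of-d ∘ suc))

-- Determinants

sumᵈ : ∀ n → (Fin n → Degree) → Degree
sumᵈ zero    w = (+ 0 , + 0)
sumᵈ (suc n) w = w zero ⊕ sumᵈ n (w ∘ suc)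

infixr 7 _·ᵈ_
_·ᵈ_ : ℕ → Degree → Degree
zero  ·ᵈ κ = (+ 0 , + 0)
suc n ·ᵈ κ = κ ⊕ n ·ᵈ κ

sumᵈ-punchIn : ∀ n (w : Fin (suc n) → Degree) j →
               sumᵈ (suc n) w ≡ w j ⊕ sumᵈ n (w ∘ punchIn j)
sumᵈ-punchIn n       w zero    = refl
sumᵈ-punchIn (suc n) w (suc j) =
  trans (cong (w zero ⊕_) (sumᵈ-punchIn n (w ∘ suc) j)) (left-comm (w zero) (w (suc j)) _)
  where
  left-comm : ∀ x y z → x ⊕ (y ⊕ z) ≡ y ⊕ (x ⊕ z)
  left-comm (a , a′) (b , b′) (c , c′) = cong₂ _,_ (ℤ-left-comm a b c) (ℤ-left-comm a′ b′ c′)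
    where
    ℤ-left-comm : ∀ a b c → a ℤ.+ (b ℤ.+ c) ≡ b ℤ.+ (a ℤ.+ c)
    ℤ-left-comm = ℤ-Solver.solve-∀

minor : ∀ n → (Fin (suc n) → Fin (suc n) → LP) → Fin (suc n) → LP
minor n M j = det n (λ r c → M (suc r) (punchIn j c))

laplaceTerm : ∀ n → (Fin (suc n) → Fin (suc n) → LP) → Fin (suc n) → LP
laplaceTerm n M j = sign (toℕ j) (M zero j *L minor n M j)

det-AllOfDegree : ∀ n M κ (col row : Fin n → Degree) →
                  (∀ a b → AllOfDegree (M a b) (κ ⊕ (col b ⊖ row a))) →
                  AllOfDegree (det n M) (n ·ᵈ κ ⊕ (sumᵈ n col ⊖ sumᵈ n row))
det-AllOfDegree zero    M κ col row graded = refl ∷ []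
det-AllOfDegree (suc n) M κ col row graded =
  sumFin-AllOfDegree (suc n) (laplaceTerm n M) _ λ j →
  sign-AllOfDegree (toℕ j) _ _
    (subst (AllOfDegree (M zero j *L minor n M j)) (degree≡ j)
      (*L-AllOfDegree (M zero j) (minor n M j) _ _ (graded zero j)
        (det-AllOfDegree n (λ r c → M (suc r) (punchIn j c)) κ (col ∘ punchIn j) (row ∘ suc)
                         (λ r c → graded (suc r) (punchIn j c)))))
  where
  regroup : ∀ x y z u v w →
            (x ⊕ (y ⊖ z)) ⊕ (u ⊕ (v ⊖ w)) ≡ (x ⊕ u) ⊕ ((y ⊕ v) ⊖ (z ⊕ w))
  regroup (x , x′) (y , y′) (z , z′) (u , u′) (v , v′) (w , w′) =
    cong₂ _,_ (ℤ-regroup x y z u v w) (ℤ-regroup x′ y′ z′ u′ v′ w′)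
    where
    ℤ-regroup : ∀ x y z u v w → (x ℤ.+ (y ℤ.- z)) ℤ.+ (u ℤ.+ (v ℤ.- w))
                                ≡ (x ℤ.+ u) ℤ.+ ((y ℤ.+ v) ℤ.- (z ℤ.+ w))
    ℤ-regroup = ℤ-Solver.solve-∀
  degree≡ : ∀ j → (κ ⊕ (col j ⊖ row zero))
                  ⊕ (n ·ᵈ κ ⊕ (sumᵈ n (col ∘ punchIn j) ⊖ sumᵈ n (row ∘ suc)))
                  ≡ suc n ·ᵈ κ ⊕ (sumᵈ (suc n) col ⊖ sumᵈ (suc n) row)
  degree≡ j = trans (regroup κ (col j) (row zero) (n ·ᵈ κ) _ _)
                    (cong (λ s → suc n ·ᵈ κ ⊕ (s ⊖ sumᵈ (suc n) row)) (sym (sumᵈ-punchIn n col j)))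

sumFin-cong : ∀ n (f g : Fin n → LP) → (∀ j → f j ≈ g j) → sumFin n f ≈ sumFin n g
sumFin-cong zero    f g f≈g = λ _ → refl
sumFin-cong (suc n) f g f≈g =
  +L-cong (f zero) (g zero) _ _ (f≈g zero) (sumFin-cong n (f ∘ suc) (g ∘ suc) (f≈g ∘ suc))

det-cong : ∀ n M M′ → (∀ a b → M a b ≈ M′ a b) → det n M ≈ det n M′
det-cong zero    M M′ M≈M′ = λ _ → refl
det-cong (suc n) M M′ M≈M′ = sumFin-cong (suc n) (laplaceTerm n M) (laplaceTerm n M′) λ j →
  sign-cong (toℕ j) _ _
    (*L-cong (M zero j) (M′ zero j) (minor n M j) (minor n M′ j) (M≈M′ zero j)
             (det-cong n (λ r c → M (suc r) (punchIn j c)) (λ r c → M′ (suc r) (punchIn j c))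
                         (λ r c → M≈M′ (suc r) (punchIn j c))))

minor-cong : ∀ n M M′ → (∀ r c → M (suc r) c ≈ M′ (suc r) c) →
             ∀ j → minor n M j ≈ minor n M′ j
minor-cong n M M′ lower j = det-cong n _ _ (λ r c → lower r (punchIn j c))

sumFin-update : ∀ n (f g : Fin n → LP) j₀ → (∀ j → j ≢ j₀ → f j ≈ g j) →
                (sumFin n f +L g j₀) ≈ (sumFin n g +L f j₀)
sumFin-update (suc n) f g zero f≈g = begin
  (f zero +L F) +L g zero   ≈⟨ +L-comm (f zero +L F) (g zero) ⟩
  g zero +L (f zero +L F)   ≈⟨ +L-cong (g zero) (g zero) _ _ (λ _ → refl) (+L-comm (f zero) F) ⟩
  g zero +L (F +L f zero)   ≡⟨ ++-assoc (g zero) F (f zero) ⟨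
  (g zero +L F) +L f zero   ≈⟨ +L-cong (g zero +L F) (g zero +L G) (f zero) (f zero)
                                 (+L-cong (g zero) (g zero) F G (λ _ → refl)
                                          (sumFin-cong n (f ∘ suc) (g ∘ suc) (λ j → f≈g (suc j) (λ ()))))
                                 (λ _ → refl) ⟩
  (g zero +L G) +L f zero   ∎
  where
  open SetoidReasoning ≈-setoid
  F = sumFin n (f ∘ suc)
  G = sumFin n (g ∘ suc)
sumFin-update (suc n) f g (suc j₀) f≈g = begin
  (f zero +L F) +L g (suc j₀)   ≡⟨ ++-assoc (f zero) F (g (suc j₀)) ⟩
  f zero +L (F +L g (suc j₀))   ≈⟨ +L-cong (f zero) (g zero) _ _ (f≈g zero (λ ()))
                                     (sumFin-update n (f ∘ suc) (g ∘ suc) j₀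
                                        (λ j j≢j₀ → f≈g (suc j) (j≢j₀ ∘ FinP.suc-injective))) ⟩
  g zero +L (G +L f (suc j₀))   ≡⟨ ++-assoc (g zero) G (f (suc j₀)) ⟨
  (g zero +L G) +L f (suc j₀)   ∎
  where
  open SetoidReasoning ≈-setoid
  F = sumFin n (f ∘ suc)
  G = sumFin n (g ∘ suc)

det-update : ∀ n (M M′ : Fin (suc n) → Fin (suc n) → LP) j₀ →
             (∀ r c → M (suc r) c ≈ M′ (suc r) c) →
             (∀ j → j ≢ j₀ → M zero j ≈ M′ zero j) →
             (det (suc n) M +L laplaceTerm n M′ j₀) ≈ (det (suc n) M′ +L laplaceTerm n M j₀)
det-update n M M′ j₀ lower first =
  sumFin-update (suc n) (laplaceTerm n M) (laplaceTerm n M′) j₀ λ j j≢j₀ →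
  sign-cong (toℕ j) _ _ (*L-cong (M zero j) (M′ zero j) (minor n M j) (minor n M′ j)
                                  (first j j≢j₀) (minor-cong n M M′ lower j))

-- The matrices defining 𝓔ᵢ

ℓ-degree : ℕ → Degree
ℓ-degree j = (+ j , + (j ∸ 1))

deg-staircase-suc : ∀ i₀ →
                    deg (staircase (suc i₀)) ≡ ℓ-degree (suc i₀) ⊕ deg (staircase (i₀ ∸ 1))
deg-staircase-suc zero    = refl
deg-staircase-suc (suc _) = refl

·ᵈ-+ : ∀ k a b → k ·ᵈ (+ a , + b) ≡ (+ (k ℕ.* a) , + (k ℕ.* b))
·ᵈ-+ zero    a b = refl
·ᵈ-+ (suc k) a b rewrite ·ᵈ-+ k a b = refl

deg-staircase : ∀ i → deg (staircase i) ≡ ⌈ i /2⌉ ·ᵈ (+ suc ⌊ i /2⌋ , + ⌊ i /2⌋)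
deg-staircase zero          = refl
deg-staircase (suc zero)    = refl
deg-staircase (suc (suc i))
  rewrite deg-staircase-suc (suc i) | deg-staircase i
        | ·ᵈ-+ ⌈ i /2⌉ (suc ⌊ i /2⌋) ⌊ i /2⌋
        | ·ᵈ-+ (suc ⌈ i /2⌉) (suc (suc ⌊ i /2⌋)) (suc ⌊ i /2⌋) =
  cong₂ _,_ (cong +_ (odd ⌊ i /2⌋ ⌈ i /2⌉ i (ℕP.⌊n/2⌋+⌈n/2⌉≡n i)))
            (cong +_ (even ⌊ i /2⌋ ⌈ i /2⌉ i (ℕP.⌊n/2⌋+⌈n/2⌉≡n i)))
  where
  odd : ∀ h k n → h ℕ.+ k ≡ n → suc (suc n) ℕ.+ k ℕ.* suc h ≡ suc k ℕ.* suc (suc h)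
  odd h k _ refl = solve h k
    where
    solve : ∀ h k → suc (suc (h ℕ.+ k)) ℕ.+ k ℕ.* suc h ≡ suc k ℕ.* suc (suc h)
    solve = ℕ-Solver.solve-∀
  even : ∀ h k n → h ℕ.+ k ≡ n → suc n ℕ.+ k ℕ.* h ≡ suc k ℕ.* suc h
  even h k _ refl = solve h k
    where
    solve : ∀ h k → suc (h ℕ.+ k) ℕ.+ k ℕ.* h ≡ suc k ℕ.* suc h
    solve = ℕ-Solver.solve-∀

Mentry-suc : ∀ P a b → Mentry P (suc a) (suc b) ≡ Mentry P a b
Mentry-suc P a b with suc a ℕ.≤? suc b | a ℕ.≤? b
... | yes _         | yes _   = refl
... | no  _         | no  _   = refl
... | yes (s≤s a≤b) | no  a≰b = ⊥-elim (a≰b a≤b)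
... | no  a≰b       | yes a≤b = ⊥-elim (a≰b (s≤s a≤b))

Mentry-1 : ∀ P n → Mentry P 1 (suc n) ≡ -L P (suc n)
Mentry-1 P n with 1 ℕ.≤? suc n
... | yes _   = cong (-L_ ∘ P) (ℕP.+-comm n 1)
... | no  1≰n = ⊥-elim (1≰n (s≤s z≤n))

Mentry-cong : ∀ P Q a b → (a ≤ b → P (b ∸ a ℕ.+ 1) ≈ Q (b ∸ a ℕ.+ 1)) →
              Mentry P a b ≈ Mentry Q a b
Mentry-cong P Q a b P≈Q with a ℕ.≤? b
... | yes a≤b = -L-cong (P (b ∸ a ℕ.+ 1)) (Q (b ∸ a ℕ.+ 1)) (P≈Q a≤b)
... | no  _   = λ _ → refl

diag : ℕ → Degree
diag t = (+ t , + t)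

Mentry-AllOfDegree : ∀ P → (∀ j → AllOfDegree (P j) (ℓ-degree j)) → ∀ h x y →
                     AllOfDegree (Mentry P (suc x) (h ℕ.+ suc y)) (ℓ-degree (suc h) ⊕ (diag y ⊖ diag x))
Mentry-AllOfDegree P P-graded h x y with suc x ℕ.≤? h ℕ.+ suc y
... | no  _          = []
... | yes x<h+1+y = -L-AllOfDegree _ _ (subst (AllOfDegree (P (t ℕ.+ 1))) ℓ-degree≡ (P-graded (t ℕ.+ 1)))
  where
  t = h ℕ.+ suc y ∸ suc x
  t≡ : + t ≡ + h ℤ.+ (+ y ℤ.- + x)
  t≡ = begin
    + t                                    ≡⟨ ℤ-cancel (+ t) (+ suc x) ⟩
    + t ℤ.+ + suc x ℤ.- + suc x            ≡⟨ cong (λ n → + n ℤ.- + suc x) (ℕP.m∸n+n≡m x<h+1+y) ⟩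
    + (h ℕ.+ suc y) ℤ.- + suc x            ≡⟨ shift (+ h) (+ y) (+ x) ⟩
    + h ℤ.+ (+ y ℤ.- + x)                  ∎
    where
    open ≡-Reasoning
    ℤ-cancel : ∀ a b → a ≡ a ℤ.+ b ℤ.- b
    ℤ-cancel = ℤ-Solver.solve-∀
    shift : ∀ h y x → h ℤ.+ (+ 1 ℤ.+ y) ℤ.- (+ 1 ℤ.+ x) ≡ h ℤ.+ (y ℤ.- x)
    shift = ℤ-Solver.solve-∀
  ℓ-degree≡ : ℓ-degree (t ℕ.+ 1) ≡ ℓ-degree (suc h) ⊕ (diag y ⊖ diag x)
  ℓ-degree≡ = trans (cong ℓ-degree (ℕP.+-comm t 1))
                    (cong₂ _,_ (trans (cong (ℤ._+_ (+ 1)) t≡) (sym (ℤP.+-assoc (+ 1) (+ h) y-x))) t≡)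
    where y-x = + y ℤ.- + x

-- 𝓔 (suc i₀) P is definitionally -L det (suc ⌊ i₀ /2⌋) (𝓔-matrix i₀ P).
𝓔-matrix : ∀ i₀ → (ℕ → LP) → Fin (suc ⌊ i₀ /2⌋) → Fin (suc ⌊ i₀ /2⌋) → LP
𝓔-matrix i₀ P r c = Mentry P (suc (toℕ r)) (⌊ suc i₀ /2⌋ ℕ.+ suc (toℕ c))

corner : ∀ i₀ → Fin (suc ⌊ i₀ /2⌋)
corner i₀ = fromℕ ⌊ i₀ /2⌋

⌊1+n/2⌋+⌊n/2⌋≡n : ∀ n → ⌊ suc n /2⌋ ℕ.+ ⌊ n /2⌋ ≡ n
⌊1+n/2⌋+⌊n/2⌋≡n n = trans (ℕP.+-comm ⌊ suc n /2⌋ ⌊ n /2⌋) (ℕP.⌊n/2⌋+⌈n/2⌉≡n n)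

𝓔-matrix-corner : ∀ i₀ P → 𝓔-matrix i₀ P zero (corner i₀) ≡ -L P (suc i₀)
𝓔-matrix-corner i₀ P = trans (cong (Mentry P 1) column≡) (Mentry-1 P i₀)
  where
  open ≡-Reasoning
  h = ⌊ suc i₀ /2⌋
  column≡ : h ℕ.+ suc (toℕ (corner i₀)) ≡ suc i₀
  column≡ = begin
    h ℕ.+ suc (toℕ (corner i₀))   ≡⟨ cong (λ n → h ℕ.+ suc n) (FinP.toℕ-fromℕ ⌊ i₀ /2⌋) ⟩
    h ℕ.+ suc ⌊ i₀ /2⌋            ≡⟨ ℕP.+-suc h ⌊ i₀ /2⌋ ⟩
    suc (h ℕ.+ ⌊ i₀ /2⌋)          ≡⟨ cong suc (⌊1+n/2⌋+⌊n/2⌋≡n i₀) ⟩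
    suc i₀                        ∎

entryIndex-bound : ∀ h k x y → suc x ≤ h ℕ.+ suc y → y < k ℕ.+ x →
                   h ℕ.+ suc y ∸ suc x ℕ.+ 1 ≤ h ℕ.+ k
entryIndex-bound h k x y x<h+1+y y<k+x = ℕP.+-cancelʳ-≤ x (t ℕ.+ 1) (h ℕ.+ k) (begin
  t ℕ.+ 1 ℕ.+ x      ≡⟨ ℕP.+-assoc t 1 x ⟩
  t ℕ.+ suc x        ≡⟨ ℕP.m∸n+n≡m x<h+1+y ⟩
  h ℕ.+ suc y        ≤⟨ ℕP.+-monoʳ-≤ h y<k+x ⟩
  h ℕ.+ (k ℕ.+ x)    ≡⟨ ℕP.+-assoc h k x ⟨
  h ℕ.+ k ℕ.+ x      ∎)
  where
  open ℕP.≤-Reasoning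
  t = h ℕ.+ suc y ∸ suc x

module _ (i₀ : ℕ) (P Q : ℕ → LP) (P≈Q : ∀ j → 1 ≤ j → j ≤ i₀ → P j ≈ Q j) where

  private
    h = ⌊ suc i₀ /2⌋
    k = ⌊ i₀ /2⌋

  𝓔-matrix-entry-cong : ∀ x y → y < k ℕ.+ x →
                        Mentry P (suc x) (h ℕ.+ suc y) ≈ Mentry Q (suc x) (h ℕ.+ suc y)
  𝓔-matrix-entry-cong x y y<k+x = Mentry-cong P Q _ _ λ x<h+1+y →
    P≈Q _ (ℕP.m≤n+m 1 _) (subst (h ℕ.+ suc y ∸ suc x ℕ.+ 1 ≤_) (⌊1+n/2⌋+⌊n/2⌋≡n i₀)
                                (entryIndex-bound h k x y x<h+1+y y<k+x))

  𝓔-matrix-lower-cong : ∀ r c → 𝓔-matrix i₀ P (suc r) c ≈ 𝓔-matrix i₀ Q (suc r) c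
  𝓔-matrix-lower-cong r c = 𝓔-matrix-entry-cong (suc (toℕ r)) (toℕ c)
    (ℕP.≤-<-trans (FinP.toℕ≤pred[n] c) (ℕP.m<m+n k (s≤s z≤n)))

  𝓔-matrix-first-cong : ∀ c → c ≢ corner i₀ → 𝓔-matrix i₀ P zero c ≈ 𝓔-matrix i₀ Q zero c
  𝓔-matrix-first-cong c c≢corner = 𝓔-matrix-entry-cong 0 (toℕ c)
    (subst (toℕ c <_) (sym (ℕP.+-identityʳ k)) (ℕP.≤∧≢⇒< (FinP.toℕ≤pred[n] c) c≢k))
    where
    c≢k : toℕ c ≢ k
    c≢k c≡k = c≢corner (FinP.toℕ-injective (trans c≡k (sym (FinP.toℕ-fromℕ k))))

det-𝓔-matrix-AllOfDegree : ∀ i₀ P → (∀ j → AllOfDegree (P j) (ℓ-degree j)) →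
                           AllOfDegree (det (suc ⌊ i₀ /2⌋) (𝓔-matrix i₀ P)) (deg (staircase (suc i₀)))
det-𝓔-matrix-AllOfDegree i₀ P P-graded =
  subst (AllOfDegree _) (trans (⊕-⊖-self _ (sumᵈ k (diag ∘ toℕ))) (sym (deg-staircase (suc i₀))))
        (det-AllOfDegree k (𝓔-matrix i₀ P) (ℓ-degree (suc h)) (diag ∘ toℕ) (diag ∘ toℕ)
                         (λ r c → Mentry-AllOfDegree P P-graded h (toℕ r) (toℕ c)))
  where
  h = ⌊ suc i₀ /2⌋
  k = suc ⌊ i₀ /2⌋

toℕ-punchIn-fromℕ : ∀ n (c : Fin n) → toℕ (punchIn (fromℕ n) c) ≡ toℕ c
toℕ-punchIn-fromℕ (suc n) zero    = refl
toℕ-punchIn-fromℕ (suc n) (suc c) = cong suc (toℕ-punchIn-fromℕ n c)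

𝓔-matrix-cornerMinor : ∀ i₁ P →
                       minor (suc ⌊ i₁ /2⌋) (𝓔-matrix (suc (suc i₁)) P) (corner (suc (suc i₁)))
                       ≈ det (suc ⌊ i₁ /2⌋) (𝓔-matrix i₁ P)
𝓔-matrix-cornerMinor i₁ P = det-cong (suc ⌊ i₁ /2⌋) shifted (𝓔-matrix i₁ P) λ r c m →
  cong (λ q → coeff q m)
       (trans (Mentry-suc P (suc (toℕ r)) (h ℕ.+ suc (toℕ (punchIn j c))))
              (cong (λ n → Mentry P (suc (toℕ r)) (h ℕ.+ suc n)) (toℕ-punchIn-fromℕ _ c)))
  where
  h = ⌊ suc i₁ /2⌋
  j = corner (suc (suc i₁))
  shifted : Fin (suc ⌊ i₁ /2⌋) → Fin (suc ⌊ i₁ /2⌋) → LP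
  shifted r c = 𝓔-matrix (suc (suc i₁)) P (suc r) (punchIn j c)

cornerMinor : ∀ i₀ → (ℕ → LP) → LP
cornerMinor i₀ P = minor ⌊ i₀ /2⌋ (𝓔-matrix i₀ P) (corner i₀)

cornerProduct : ∀ i₀ → (ℕ → LP) → LP
cornerProduct i₀ P = 𝓔-matrix i₀ P zero (corner i₀) *L cornerMinor i₀ P

coeff-cornerProduct : ∀ i₀ P d e → cornerMinor i₀ P ≈ ((d , e) ∷ []) → ∀ m →
                      coeff (cornerProduct i₀ P) (addExps m e) ≡ - (coeff (P (suc i₀)) m * d)
coeff-cornerProduct i₀ P d e C≈de m = begin
  coeff (cornerProduct i₀ P) m⁺      ≡⟨ cong (λ p → coeff (p *L C) m⁺) (𝓔-matrix-corner i₀ P) ⟩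
  coeff ((-L p) *L C) m⁺             ≡⟨ -L-*L p C m⁺ ⟩
  coeff (-L (p *L C)) m⁺             ≡⟨ coeff--L (p *L C) m⁺ ⟩
  - coeff (p *L C) m⁺                ≡⟨ cong -_ (*L-congʳ p C _ C≈de m⁺) ⟩
  - coeff (p *L ((d , e) ∷ [])) m⁺   ≡⟨ cong -_ (coeff-*L-monomial p d e m⁺) ⟩
  - (coeff p (subExps m⁺ e) * d)     ≡⟨ cong (λ x → - (x * d)) (coeff-≋ p (subExps-addExps m e)) ⟩
  - (coeff p m * d)                  ∎
  where
  open ≡-Reasoning
  p  = P (suc i₀)
  C  = cornerMinor i₀ P
  m⁺ = addExps m e

*-±1-zero : ∀ x d → d ≡ 1ℚ ⊎ d ≡ - 1ℚ → x * d ≡ 0ℚ → x ≡ 0ℚ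
*-±1-zero x d (inj₁ refl) x*d≡0 = trans (sym (ℚP.*-identityʳ x)) x*d≡0
*-±1-zero x d (inj₂ refl) x*d≡0 = ℚP.neg-injective (trans (sym (*-1 x)) x*d≡0)
  where
  *-1 : ∀ x → x * - 1ℚ ≡ - x
  *-1 = solve-∀ ℚ-ring

module _ (ℓ : ℕ → LP) (ℓ-𝓔 : ∀ i → 1 ≤ i → 𝓔 i ℓ ≈ stairMono i) where

  cornerMinor-unitMonomial : ∀ i₀ → Σ[ d ∈ ℚ ] (d ≡ 1ℚ ⊎ d ≡ - 1ℚ) ×
                                    cornerMinor i₀ ℓ ≈ ((d , staircase (i₀ ∸ 1)) ∷ [])
  cornerMinor-unitMonomial zero           = 1ℚ , inj₁ refl , λ _ → refl
  cornerMinor-unitMonomial (suc zero)     = 1ℚ , inj₁ refl , λ _ → refl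
  cornerMinor-unitMonomial (suc (suc i₁)) = - 1ℚ , inj₂ refl , (begin
    cornerMinor (suc (suc i₁)) ℓ   ≈⟨ 𝓔-matrix-cornerMinor i₁ ℓ ⟩
    D                              ≈⟨ -L-involutive D ⟨
    -L 𝓔 (suc i₁) ℓ               ≈⟨ -L-cong (𝓔 (suc i₁) ℓ) S (ℓ-𝓔 (suc i₁) (s≤s z≤n)) ⟩
    -L S                           ∎)
    where
    open SetoidReasoning ≈-setoid
    D = det (suc ⌊ i₁ /2⌋) (𝓔-matrix i₁ ℓ)
    S = stairMono (suc i₁)

  ℓ⁰ : ℕ → LP
  ℓ⁰ j = component (ℓ-degree j) (ℓ j)

  cornerTerms-agree : ∀ i₀ → (∀ j → 1 ≤ j → j ≤ i₀ → ℓ j ≈ ℓ⁰ j) →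
                      ∀ m → ¬ deg m ≡ deg (staircase (suc i₀)) →
                      coeff (laplaceTerm ⌊ i₀ /2⌋ (𝓔-matrix i₀ ℓ) (corner i₀)) m
                      ≡ coeff (laplaceTerm ⌊ i₀ /2⌋ (𝓔-matrix i₀ ℓ⁰) (corner i₀)) m
  cornerTerms-agree i₀ ℓ≈ℓ⁰ m m-off = begin
    coeff T m                        ≡⟨ ℚP.+-identityˡ (coeff T m) ⟨
    0ℚ + coeff T m                   ≡⟨ cong (_+ coeff T m) det⁰≡0 ⟨
    coeff (det k M⁰) m + coeff T m   ≡⟨ coeff-+L (det k M⁰) T m ⟨
    coeff (det k M⁰ +L T) m          ≡⟨ det-update ⌊ i₀ /2⌋ M M⁰ (corner i₀)
                                                   (𝓔-matrix-lower-cong i₀ ℓ ℓ⁰ ℓ≈ℓ⁰)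
                                                   (𝓔-matrix-first-cong i₀ ℓ ℓ⁰ ℓ≈ℓ⁰) m ⟨
    coeff (det k M +L T⁰) m          ≡⟨ coeff-+L (det k M) T⁰ m ⟩
    coeff (det k M) m + coeff T⁰ m   ≡⟨ cong (_+ coeff T⁰ m) det≡0 ⟩
    0ℚ + coeff T⁰ m                  ≡⟨ ℚP.+-identityˡ (coeff T⁰ m) ⟩
    coeff T⁰ m                       ∎
    where
    open ≡-Reasoning
    k  = suc ⌊ i₀ /2⌋
    M  = 𝓔-matrix i₀ ℓ
    M⁰ = 𝓔-matrix i₀ ℓ⁰
    T  = laplaceTerm ⌊ i₀ /2⌋ M (corner i₀)
    T⁰ = laplaceTerm ⌊ i₀ /2⌋ M⁰ (corner i₀)
    S  = stairMono (suc i₀)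
    det≡0 : coeff (det k M) m ≡ 0ℚ
    det≡0 = trans (sym (-L-involutive (det k M) m))
                  (trans (-L-cong (𝓔 (suc i₀) ℓ) S (ℓ-𝓔 (suc i₀) (s≤s z≤n)) m)
                         (coeff-offDegree (-L S) _ m (-L-AllOfDegree S _ (refl ∷ [])) m-off))
    det⁰≡0 : coeff (det k M⁰) m ≡ 0ℚ
    det⁰≡0 = coeff-offDegree _ _ m (det-𝓔-matrix-AllOfDegree i₀ ℓ⁰ (λ j → all-filter _ (ℓ j)))
                             m-off

  offDegree-coeff-vanishes : ∀ i₀ → (∀ j → 1 ≤ j → j ≤ i₀ → Homogeneous (ℓ j) (ℓ-degree j)) →
                             ∀ m → ¬ deg m ≡ ℓ-degree (suc i₀) →
                             coeff (ℓ (suc i₀)) m ≡ 0ℚ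
  offDegree-coeff-vanishes i₀ IH m m-off with cornerMinor-unitMonomial i₀
  ... | d , d≡±1 , C≈de = *-±1-zero (coeff (ℓ (suc i₀)) m) d d≡±1 (ℚP.neg-injective (begin
    - (coeff (ℓ (suc i₀)) m * d)     ≡⟨ coeff-cornerProduct i₀ ℓ d e C≈de m ⟨
    coeff (cornerProduct i₀ ℓ) m⁺    ≡⟨ coeff-sign-injective (toℕ (corner i₀)) _ _ m⁺
                                           (cornerTerms-agree i₀ ℓ≈ℓ⁰ m⁺ m⁺-off) ⟩
    coeff (cornerProduct i₀ ℓ⁰) m⁺   ≡⟨ coeff-cornerProduct i₀ ℓ⁰ d e C⁰≈de m ⟩
    - (coeff (ℓ⁰ (suc i₀)) m * d)    ≡⟨ cong (λ x → - (x * d)) ℓ⁰-off ⟩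
    - (0ℚ * d)                       ≡⟨ cong -_ (ℚP.*-zeroˡ d) ⟩
    - 0ℚ                             ∎))
    where
    open ≡-Reasoning
    e  = staircase (i₀ ∸ 1)
    m⁺ = addExps m e
    ℓ≈ℓ⁰ : ∀ j → 1 ≤ j → j ≤ i₀ → ℓ j ≈ ℓ⁰ j
    ℓ≈ℓ⁰ j 1≤j j≤i₀ = Homogeneous⇒≈component (ℓ j) (ℓ-degree j) (IH j 1≤j j≤i₀)
    C⁰≈de : cornerMinor i₀ ℓ⁰ ≈ ((d , e) ∷ [])
    C⁰≈de n = trans (sym (minor-cong ⌊ i₀ /2⌋ (𝓔-matrix i₀ ℓ) (𝓔-matrix i₀ ℓ⁰)
                                     (𝓔-matrix-lower-cong i₀ ℓ ℓ⁰ ℓ≈ℓ⁰) (corner i₀) n))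
                    (C≈de n)
    m⁺-off : ¬ deg m⁺ ≡ deg (staircase (suc i₀))
    m⁺-off eq = m-off (⊕-cancelʳ (deg m) (ℓ-degree (suc i₀)) (deg e)
                        (trans (sym (deg-addExps m e)) (trans eq (deg-staircase-suc i₀))))
    ℓ⁰-off : coeff (ℓ⁰ (suc i₀)) m ≡ 0ℚ
    ℓ⁰-off = coeff-offDegree (ℓ⁰ (suc i₀)) (ℓ-degree (suc i₀)) m
                             (all-filter _ (ℓ (suc i₀))) m-off

proposition3p5 : (ℓ : ℕ → LP)
    → (∀ i → 1 ≤ i → 𝓔 i ℓ ≈ stairMono i)
    → ∀ i → 1 ≤ i → Homogeneous (ℓ i) (+ i , + (i ∸ 1))
proposition3p5 ℓ ℓ-𝓔 i 1≤i = homogeneous-upTo i i 1≤i ℕP.≤-refl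
  where
  homogeneous-upTo : ∀ n j → 1 ≤ j → j ≤ n → Homogeneous (ℓ j) (ℓ-degree j)
  homogeneous-upTo zero    (suc _)  _ ()
  homogeneous-upTo (suc n) (suc i₀) _ (s≤s i₀≤n) =
    offDegree-vanishing⇒Homogeneous (ℓ (suc i₀)) (ℓ-degree (suc i₀))
      (offDegree-coeff-vanishes ℓ ℓ-𝓔 i₀ λ j 1≤j j≤i₀ →
         homogeneous-upTo n j 1≤j (ℕP.≤-trans j≤i₀ i₀≤n))
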